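{- The statistics $(2\text{ - }31)$ and $(13\text{ - }2)$ are constant on every orbit of $\mathfrak{S}_n$ under the modified Foata–Strehl action.
   Context: For $\pi=a_1\cdots a_n\in\mathfrak{S}_n$: $(2\text{ - }31)(\pi)$ is the number of pairs $1\le i<j\le n-1$ with $a_{j+1}<a_i<a_j$, and $(13\text{ - }2)(\pi)$ is the number of pairs $2\le i<j\le n$ with $a_{i-1}<a_j<a_i$. Modified Foata–Strehl action: set $a_0=a_{n+1}=n+1$; a letter $a_k$ is a valley if $a_{k-1}>a_k<a_{k+1}$, a peak if $a_{k-1}<a_k>a_{k+1}$, a double ascent if $a_{k-1}<a_k<a_{k+1}$, a double descent if $a_{k-1}>a_k>a_{k+1}$. For $x\in[n]$ write $\pi=w_1w_2xw_4w_5$ where $w_2$ (resp. $w_4$) is the maximal contiguous subword immediately left (resp. right) of $x$ all of whose letters are smaller than $x$, and set $\varphi_x(\pi)=w_1w_4xw_2w_5$. Let $\varphi'_x(\pi)=\varphi_x(\pi)$ if $x$ is a double ascent or double descent, and $\varphi'_x(\pi)=\pi$ if $x$ is a peak or valley. These are commuting involutions and $\mathbb{Z}_2^n$ acts via $\varphi'_S=\prod_{x\in S}\varphi'_x$, $S\subseteq[n]$; orbits are the sets $\{\varphi'_S(\pi):S\subseteq[n]\}$. -}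

module Defs where

open import Data.Bool using (Bool; true; false; if_then_else_; _∧_; _∨_)
open import Data.Nat using (ℕ; zero; suc; _∸_; _<ᵇ_; _≡ᵇ_)
open import Data.List using (List; []; _∷_; _++_; reverse; length; filter; applyUpTo; allFin; foldl; concatMap)
open import Data.Maybe using (Maybe; just; nothing)
open import Data.Product using (_×_; _,_)
open import Data.Fin using (Fin; toℕ)
open import Data.Fin.Subset using (Subset)
open import Data.Vec using (lookup)
open import Data.List.Relation.Binary.Permutation.Propositional using (_↭_)
open import Relation.Binary.PropositionalEquality using (_≡_)

IsPerm : ℕ → List ℕ → Set
IsPerm n π = π ↭ applyUpTo suc n

-- 1-indexed entry a_k (default 0 outside range; never used out of range below)
at : List ℕ → ℕ → ℕ
at []       _             = 0
at (x ∷ xs) zero          = 0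
at (x ∷ xs) (suc zero)    = x
at (x ∷ xs) (suc (suc k)) = at xs (suc k)

-- [a .. b] for a ≤ b (empty otherwise)
range : ℕ → ℕ → List ℕ
range a b = applyUpTo (λ k → a Data.Nat.+ k) (suc b ∸ a)

pairs : ℕ → ℕ → List (ℕ × ℕ)
pairs lo hi = concatMap (λ i → Data.List.map (λ j → i , j) (range (suc i) hi)) (range lo hi)

countB : {A : Set} → (A → Bool) → List A → ℕ
countB p []       = 0
countB p (x ∷ xs) = if p x then suc (countB p xs) else countB p xs

stat2-31 : List ℕ → ℕ
stat2-31 π = countB (λ { (i , j) → (at π (suc j) <ᵇ at π i) ∧ (at π i <ᵇ at π j) })
                    (pairs 1 (length π ∸ 1))

stat13-2 : List ℕ → ℕ
stat13-2 π = countB (λ { (i , j) → (at π (i ∸ 1) <ᵇ at π j) ∧ (at π j <ᵇ at π i) })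
                    (pairs 2 (length π))

breakAt : ℕ → List ℕ → Maybe (List ℕ × List ℕ)
breakAt x [] = nothing
breakAt x (y ∷ ys) with y ≡ᵇ x
... | true  = just ([] , ys)
... | false with breakAt x ys
...   | nothing         = nothing
...   | just (pre , po) = just (y ∷ pre , po)

spanB : (ℕ → Bool) → List ℕ → List ℕ × List ℕ
spanB p [] = [] , []
spanB p (y ∷ ys) with p y
... | false = [] , y ∷ ys
... | true with spanB p ys
...   | (a , b) = y ∷ a , b

-- Foata–Strehl φ_x : w₁ w₂ x w₄ w₅ ↦ w₁ w₄ x w₂ w₅
φ : ℕ → List ℕ → List ℕ
φ x π with breakAt x π
... | nothing = π
... | just (pre , post) with spanB (_<ᵇ x) (reverse pre) | spanB (_<ᵇ x) post
...   | (rw₂ , rw₁) | (w₄ , w₅) = reverse rw₁ ++ w₄ ++ x ∷ reverse rw₂ ++ w₅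

-- left / right neighbours with the convention a₀ = a_{n+1} = n+1
leftNb : ℕ → List ℕ → ℕ
leftNb n pre with reverse pre
... | []    = suc n
... | y ∷ _ = y

rightNb : ℕ → List ℕ → ℕ
rightNb n []      = suc n
rightNb n (y ∷ _) = y

isDoubleAscent : ℕ → ℕ → List ℕ → Bool
isDoubleAscent n x π with breakAt x π
... | nothing = false
... | just (pre , post) = (leftNb n pre <ᵇ x) ∧ (x <ᵇ rightNb n post)

isDoubleDescent : ℕ → ℕ → List ℕ → Bool
isDoubleDescent n x π with breakAt x π
... | nothing = false
... | just (pre , post) = (x <ᵇ leftNb n pre) ∧ (rightNb n post <ᵇ x)

φ′ : ℕ → ℕ → List ℕ → List ℕ
φ′ n x π = if isDoubleAscent n x π ∨ isDoubleDescent n x π then φ x π else π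

-- φ'_S = ∏_{x∈S} φ'_x, S ⊆ [n] given as Subset n (index i ↔ letter i+1),
-- applied in increasing order of x
φ′S : (n : ℕ) → Subset n → List ℕ → List ℕ
φ′S n S π = foldl (λ acc i → if lookup S i then φ′ n (suc (toℕ i)) acc else acc) π (allFin n)

-- (13-2)(π) counts the pairs (adjacent ascent p q, later letter y) with p < y < q, and
-- (2-31)(π) = (13-2)(reverse π).  When φ′_x acts nontrivially, x is a double ascent or
-- descent, and φ_x just lets x jump over the maximal run w of smaller letters on one side
-- of it; the letters framing the block w x are larger than x.  So the pairs at the left end
-- of the block are descents before and after the jump, ascents inside w cannot straddle x,
-- and pairs outside the block see the same letters after them.  What remains is the right
-- end: in  … w_k x b …  the ascents (w_k, x) and (x, b) together count the later letters in
-- (w_k, b) other than x, exactly as the single ascent (w_k, b) does after the jump.  The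
-- reverse of such a jump is again one, so the same argument gives (2-31).
module Submission where

open import Algebra.Properties.CommutativeSemigroup using (interchange)
open import Data.Bool using (Bool; true; false; _∧_; T; if_then_else_)
open import Data.Bool.Properties using (∧-zeroʳ)
open import Data.Empty using (⊥-elim)
open import Data.Fin using (toℕ)
open import Data.Fin.Subset using (Subset)
open import Data.List
  using (List; []; _∷_; _++_; _ʳ++_; reverse; head; length; applyUpTo; concatMap; foldl; allFin)
open import Data.List.Properties
  using (map-applyUpTo; reverse-++; unfold-reverse; ʳ++-defn; ++-ʳ++; reverse-involutive; ++-assoc)
open import Data.List.Relation.Binary.Permutation.Propositional as ↭ using (_↭_; ↭⇒↭ₛ)
open import Data.List.Relation.Binary.Permutation.Propositional.Properties
  using (All-resp-↭; ↭-reverse; shift; ++⁺ˡ)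
open import Data.List.Relation.Unary.All as All using (All; []; _∷_)
open import Data.List.Relation.Unary.All.Properties using (++⁻)
open import Data.List.Relation.Unary.AllPairs using (_∷_)
open import Data.List.Relation.Unary.Unique.Propositional using (Unique)
open import Data.List.Relation.Unary.Unique.Propositional.Properties using (applyUpTo⁺₁)
open import Data.Maybe using (just; nothing)
open import Data.Maybe.Relation.Unary.All as Maybe using (just; nothing)
open import Data.Nat using (ℕ; zero; suc; _+_; _∸_; _<_; _≤_; _<ᵇ_; _≡ᵇ_; _<?_)
open import Data.Nat.Properties
  using ( +-assoc; +-comm; +-identityʳ; +-commutativeSemigroup; <-cmp; <-trans; ≤-<-trans
        ; <⇒≤; <⇒≯; <⇒≢; ≤∧≢⇒<; ≮⇒≥; suc-injective; <ᵇ⇒<; <⇒<ᵇ; <ᵇ-reflects-<; ≡ᵇ⇒≡ )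
open import Data.Product using (_×_; _,_; ∃-syntax; proj₂)
open import Data.Vec using (lookup)
open import Defs
open import Function using (_∘_; flip)
open import Relation.Binary.Definitions using (tri<; tri≈; tri>)
open import Relation.Binary.PropositionalEquality
  using (_≡_; _≢_; refl; sym; trans; cong; cong₂; subst; subst₂; setoid; module ≡-Reasoning)
open import Relation.Nullary using (¬_; yes; no; ofʸ; ofⁿ)
open import Relation.Nullary.Reflects using (Reflects; det)

open import Data.List.Relation.Binary.Permutation.Setoid.Properties (setoid ℕ) using (Unique-resp-↭)

ind : Bool → ℕ
ind true  = 1
ind false = 0

∑ : ℕ → (ℕ → ℕ) → ℕ
∑ zero    f = 0
∑ (suc n) f = f 0 + ∑ n (f ∘ suc)

∑-cong : ∀ n {f g : ℕ → ℕ} → (∀ k → f k ≡ g k) → ∑ n f ≡ ∑ n g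
∑-cong zero    f≗g = refl
∑-cong (suc n) f≗g = cong₂ _+_ (f≗g 0) (∑-cong n (f≗g ∘ suc))

module _ {A : Set} (p : A → Bool) where

  countB-∷ : ∀ x xs → countB p (x ∷ xs) ≡ ind (p x) + countB p xs
  countB-∷ x xs with p x
  ... | true  = refl
  ... | false = refl

  countB-++ : ∀ xs ys → countB p (xs ++ ys) ≡ countB p xs + countB p ys
  countB-++ []       ys = refl
  countB-++ (x ∷ xs) ys with p x
  ... | true  = cong suc (countB-++ xs ys)
  ... | false = countB-++ xs ys

  countB-applyUpTo : ∀ (f : ℕ → A) n → countB p (applyUpTo f n) ≡ ∑ n (ind ∘ p ∘ f)
  countB-applyUpTo f zero    = refl
  countB-applyUpTo f (suc n) =
    trans (countB-∷ (f 0) (applyUpTo (f ∘ suc) n)) (cong (ind (p (f 0)) +_) (countB-applyUpTo (f ∘ suc) n))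

  countB-concatMap-applyUpTo : ∀ {B : Set} (h : B → List A) (f : ℕ → B) n →
    countB p (concatMap h (applyUpTo f n)) ≡ ∑ n (countB p ∘ h ∘ f)
  countB-concatMap-applyUpTo h f zero    = refl
  countB-concatMap-applyUpTo h f (suc n) =
    trans (countB-++ (h (f 0)) (concatMap h (applyUpTo (f ∘ suc) n)))
          (cong (countB p (h (f 0)) +_) (countB-concatMap-applyUpTo h (f ∘ suc) n))

module _ {A : Set} {p : A → Bool} where

  countB-skip : ∀ xs {y ys} → p y ≡ false → countB p (xs ++ y ∷ ys) ≡ countB p (xs ++ ys)
  countB-skip []       py≡false rewrite py≡false = refl
  countB-skip (x ∷ xs) py≡false with p x
  ... | true  = cong suc (countB-skip xs py≡false)
  ... | false = countB-skip xs py≡false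

  countB-none : (∀ y → p y ≡ false) → ∀ xs → countB p xs ≡ 0
  countB-none p≡false []       = refl
  countB-none p≡false (x ∷ xs) rewrite p≡false x = countB-none p≡false xs

  countB-↭ : ∀ {xs ys} → xs ↭ ys → countB p xs ≡ countB p ys
  countB-↭ ↭.refl = refl
  countB-↭ (↭.prep x xs↭ys) with p x
  ... | true  = cong suc (countB-↭ xs↭ys)
  ... | false = countB-↭ xs↭ys
  countB-↭ (↭.swap x y xs↭ys) with p x | p y
  ... | true  | true  = cong (suc ∘ suc) (countB-↭ xs↭ys)
  ... | true  | false = cong suc (countB-↭ xs↭ys)
  ... | false | true  = cong suc (countB-↭ xs↭ys)
  ... | false | false = countB-↭ xs↭ys
  countB-↭ (↭.trans xs↭ys ys↭zs) = trans (countB-↭ xs↭ys) (countB-↭ ys↭zs)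

countB-at : ∀ (p : ℕ → Bool) L → countB p L ≡ ∑ (length L) (λ m → ind (p (at L (suc m))))
countB-at p []      = refl
countB-at p (y ∷ L) = trans (countB-∷ p y L) (cong (ind (p y) +_) (countB-at p L))

countB-pairs : ∀ (p : ℕ × ℕ → Bool) lo hi → countB p (pairs lo hi) ≡
  ∑ (suc hi ∸ lo) (λ k → ∑ (hi ∸ (lo + k)) (λ m → ind (p (lo + k , suc (lo + k) + m))))
countB-pairs p lo hi =
  trans (countB-concatMap-applyUpTo p _ (lo +_) (suc hi ∸ lo)) (∑-cong (suc hi ∸ lo) λ k → let i = lo + k in
    trans (cong (countB p) (map-applyUpTo (suc i +_) (i ,_) (hi ∸ i)))
          (countB-applyUpTo p (λ j → i , suc i + j) (hi ∸ i)))

countAdjacent : (ℕ → ℕ → Bool) → List ℕ → ℕ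
countAdjacent r (p ∷ q ∷ L) = ind (r p q) + countAdjacent r (q ∷ L)
countAdjacent r _           = 0

countAdjacent-at : ∀ r b L →
  countAdjacent r (b ∷ L) ≡ ∑ (length L) (λ m → ind (r (at (b ∷ L) (suc m)) (at (b ∷ L) (suc (suc m)))))
countAdjacent-at r b []      = refl
countAdjacent-at r b (c ∷ L) = cong (ind (r b c) +_) (countAdjacent-at r c L)

countAdjacent-∷ʳ : ∀ r M c b →
  countAdjacent r (M ++ c ∷ b ∷ []) ≡ countAdjacent r (M ++ c ∷ []) + ind (r c b)
countAdjacent-∷ʳ r []           c b = +-identityʳ (ind (r c b))
countAdjacent-∷ʳ r (m ∷ [])     c b =
  trans (cong (ind (r m c) +_) (countAdjacent-∷ʳ r [] c b)) (sym (+-assoc (ind (r m c)) 0 _))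
countAdjacent-∷ʳ r (m ∷ m′ ∷ M) c b =
  trans (cong (ind (r m m′) +_) (countAdjacent-∷ʳ r (m′ ∷ M) c b)) (sym (+-assoc (ind (r m m′)) _ _))

countAdjacent-reverse : ∀ r L → countAdjacent r (reverse L) ≡ countAdjacent (flip r) L
countAdjacent-reverse r []          = refl
countAdjacent-reverse r (b ∷ [])    = refl
countAdjacent-reverse r (b ∷ c ∷ L) = begin
  countAdjacent r (reverse (b ∷ c ∷ L))
    ≡⟨ cong (countAdjacent r) (reverse-++ (b ∷ c ∷ []) L) ⟩
  countAdjacent r (reverse L ++ c ∷ b ∷ [])
    ≡⟨ countAdjacent-∷ʳ r (reverse L) c b ⟩
  countAdjacent r (reverse L ++ c ∷ []) + ind (r c b)
    ≡⟨ cong (λ n → countAdjacent r n + ind (r c b)) (unfold-reverse c L) ⟨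
  countAdjacent r (reverse (c ∷ L)) + ind (r c b)
    ≡⟨ cong (_+ ind (r c b)) (countAdjacent-reverse r (c ∷ L)) ⟩
  countAdjacent (flip r) (c ∷ L) + ind (r c b)
    ≡⟨ +-comm _ (ind (r c b)) ⟩
  countAdjacent (flip r) (b ∷ c ∷ L) ∎
  where open ≡-Reasoning

<ᵇ-≡ : ∀ {m n b} → Reflects (m < n) b → (m <ᵇ n) ≡ b
<ᵇ-≡ = det (<ᵇ-reflects-< _ _)

between : ℕ → ℕ → ℕ → Bool
between p q y = (p <ᵇ y) ∧ (y <ᵇ q)

between-falseˡ : ∀ {p q y} → ¬ p < y → between p q y ≡ false
between-falseˡ p≮y rewrite <ᵇ-≡ (ofⁿ p≮y) = refl

between-falseʳ : ∀ {p q y} → ¬ y < q → between p q y ≡ false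
between-falseʳ {p} {y = y} y≮q rewrite <ᵇ-≡ (ofⁿ y≮q) = ∧-zeroʳ (p <ᵇ y)

between-empty : ∀ {p q} → q ≤ p → ∀ y → between p q y ≡ false
between-empty {p} {q} q≤p y with p <? y
... | yes p<y = between-falseʳ (<⇒≯ (≤-<-trans q≤p p<y))
... | no  p≮y = between-falseˡ {q = q} p≮y

ind-between-split : ∀ {p x q} y → p < x → x < q → x ≢ y →
  ind (between p x y) + ind (between x q y) ≡ ind (between p q y)
ind-between-split {p} {x} {q} y p<x x<q x≢y with <-cmp y x
... | tri< y<x _ _ rewrite <ᵇ-≡ (ofʸ y<x) | <ᵇ-≡ (ofⁿ (<⇒≯ y<x)) | <ᵇ-≡ (ofʸ (<-trans y<x x<q)) =
  +-identityʳ _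
... | tri≈ _ y≡x _ = ⊥-elim (x≢y (sym y≡x))
... | tri> _ _ x<y rewrite <ᵇ-≡ (ofʸ x<y) | <ᵇ-≡ (ofⁿ (<⇒≯ x<y)) | <ᵇ-≡ (ofʸ (<-trans p<x x<y)) =
  refl

countB-between-split : ∀ {p x q} → p < x → x < q → ∀ {L} → All (x ≢_) L →
  countB (between p x) L + countB (between x q) L ≡ countB (between p q) L
countB-between-split p<x x<q []                     = refl
countB-between-split {p} {x} {q} p<x x<q {y ∷ L} (x≢y ∷ x∉L) = begin
  countB (between p x) (y ∷ L) + countB (between x q) (y ∷ L)
    ≡⟨ cong₂ _+_ (countB-∷ (between p x) y L) (countB-∷ (between x q) y L) ⟩
  (ind (between p x y) + countB (between p x) L) + (ind (between x q y) + countB (between x q) L)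
    ≡⟨ interchange +-commutativeSemigroup (ind (between p x y)) _ _ _ ⟩
  (ind (between p x y) + ind (between x q y)) + (countB (between p x) L + countB (between x q) L)
    ≡⟨ cong₂ _+_ (ind-between-split y p<x x<q x≢y) (countB-between-split p<x x<q x∉L) ⟩
  ind (between p q y) + countB (between p q) L
    ≡⟨ countB-∷ (between p q) y L ⟨
  countB (between p q) (y ∷ L) ∎
  where open ≡-Reasoning

-- Both statistics as occurrences of 13-2

occ13-2 : List ℕ → ℕ
occ13-2 (p ∷ q ∷ L) = countB (between p q) L + occ13-2 (q ∷ L)
occ13-2 _           = 0

-- With the sums of countB-pairs in closed form, the index shifts below hold by computation.
stat2-31-∷ : ∀ a L → stat2-31 (a ∷ L) ≡ countAdjacent (λ p q → between q p a) L + stat2-31 L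
stat2-31-∷ a []      = refl
stat2-31-∷ a (b ∷ L) = trans (countB-pairs _ 1 (suc (length L)))
  (cong₂ _+_ (sym (countAdjacent-at _ b L)) (sym (countB-pairs _ 1 (length L))))

stat13-2-∷ : ∀ b c L → stat13-2 (b ∷ c ∷ L) ≡ countB (between b c) L + stat13-2 (c ∷ L)
stat13-2-∷ b c L = trans (countB-pairs _ 2 (suc (suc (length L))))
  (cong₂ _+_ (sym (countB-at _ L)) (sym (countB-pairs _ 2 (suc (length L)))))

stat13-2≡occ13-2 : ∀ π → stat13-2 π ≡ occ13-2 π
stat13-2≡occ13-2 []          = refl
stat13-2≡occ13-2 (b ∷ [])    = refl
stat13-2≡occ13-2 (b ∷ c ∷ L) =
  trans (stat13-2-∷ b c L) (cong (countB (between b c) L +_) (stat13-2≡occ13-2 (c ∷ L)))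

occ13-2-∷ʳ : ∀ L a → occ13-2 (L ++ a ∷ []) ≡ occ13-2 L + countAdjacent (λ p q → between p q a) L
occ13-2-∷ʳ []          a = refl
occ13-2-∷ʳ (p ∷ [])    a = refl
occ13-2-∷ʳ (p ∷ q ∷ L) a = begin
  countB (between p q) (L ++ a ∷ []) + occ13-2 (q ∷ L ++ a ∷ [])
    ≡⟨ cong₂ _+_ (countB-++ (between p q) L (a ∷ [])) (occ13-2-∷ʳ (q ∷ L) a) ⟩
  (countB (between p q) L + countB (between p q) (a ∷ [])) + (occ13-2 (q ∷ L) + countAdjacent r (q ∷ L))
    ≡⟨ interchange +-commutativeSemigroup (countB (between p q) L) _ (occ13-2 (q ∷ L)) _ ⟩
  occ13-2 (p ∷ q ∷ L) + (countB (between p q) (a ∷ []) + countAdjacent r (q ∷ L))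
    ≡⟨ cong (λ n → occ13-2 (p ∷ q ∷ L) + (n + countAdjacent r (q ∷ L)))
            (trans (countB-∷ (between p q) a []) (+-identityʳ _)) ⟩
  occ13-2 (p ∷ q ∷ L) + countAdjacent r (p ∷ q ∷ L) ∎
  where
  open ≡-Reasoning
  r : ℕ → ℕ → Bool
  r p q = between p q a

stat2-31≡occ13-2∘reverse : ∀ π → stat2-31 π ≡ occ13-2 (reverse π)
stat2-31≡occ13-2∘reverse []      = refl
stat2-31≡occ13-2∘reverse (a ∷ L) = begin
  stat2-31 (a ∷ L)                                             ≡⟨ stat2-31-∷ a L ⟩
  countAdjacent (flip ascentOver) L + stat2-31 L
    ≡⟨ cong₂ _+_ (sym (countAdjacent-reverse ascentOver L)) (stat2-31≡occ13-2∘reverse L) ⟩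
  countAdjacent ascentOver (reverse L) + occ13-2 (reverse L)   ≡⟨ +-comm (countAdjacent ascentOver (reverse L)) _ ⟩
  occ13-2 (reverse L) + countAdjacent ascentOver (reverse L)   ≡⟨ occ13-2-∷ʳ (reverse L) a ⟨
  occ13-2 (reverse L ++ a ∷ [])                                ≡⟨ cong occ13-2 (unfold-reverse a L) ⟨
  occ13-2 (reverse (a ∷ L))                                    ∎
  where
  open ≡-Reasoning
  ascentOver : ℕ → ℕ → Bool
  ascentOver p q = between p q a

-- Jumps over runs of smaller letters

_<head_ : ℕ → List ℕ → Set
x <head L = Maybe.All (x <_) (head L)

occ13-2-descent : ∀ {p q} → q ≤ p → ∀ L → occ13-2 (p ∷ q ∷ L) ≡ occ13-2 (q ∷ L)
occ13-2-descent q≤p L = cong (_+ _) (countB-none (between-empty q≤p) L)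

occ13-2-delete : ∀ {x a} w {B} → All (_< x) (a ∷ w) → x <head B → All (x ≢_) B →
  occ13-2 (a ∷ w ++ x ∷ B) ≡ occ13-2 (a ∷ w ++ B)
occ13-2-delete [] {[]} _ _ _ = refl
occ13-2-delete {x} {a} [] {b ∷ B} (a<x ∷ []) (just x<b) (_ ∷ x∉B) = begin
  countB (between a x) (b ∷ B) + (countB (between x b) B + occ13-2 (b ∷ B))
    ≡⟨ cong (_+ _) (countB-skip {p = between a x} [] {ys = B} (between-falseʳ (<⇒≯ x<b))) ⟩
  countB (between a x) B + (countB (between x b) B + occ13-2 (b ∷ B))
    ≡⟨ +-assoc (countB (between a x) B) _ _ ⟨
  (countB (between a x) B + countB (between x b) B) + occ13-2 (b ∷ B)
    ≡⟨ cong (_+ occ13-2 (b ∷ B)) (countB-between-split a<x x<b x∉B) ⟩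
  countB (between a b) B + occ13-2 (b ∷ B) ∎
  where open ≡-Reasoning
occ13-2-delete (c ∷ w) (_ ∷ c<x ∷ w<x) x<B x∉B =
  cong₂ _+_ (countB-skip w (between-falseʳ (<⇒≯ c<x))) (occ13-2-delete w (c<x ∷ w<x) x<B x∉B)

occ13-2-jump : ∀ {x a} w {B} → All (_< x) (a ∷ w) → x <head B → All (x ≢_) B →
  occ13-2 (a ∷ w ++ x ∷ B) ≡ occ13-2 (x ∷ a ∷ w ++ B)
occ13-2-jump w w<x x<B x∉B =
  trans (occ13-2-delete w w<x x<B x∉B) (sym (occ13-2-descent (<⇒≤ (All.head w<x)) (w ++ _)))

occ13-2-++-cong : ∀ A {p L L′} → L ↭ L′ → occ13-2 (p ∷ L) ≡ occ13-2 (p ∷ L′) →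
  occ13-2 (A ++ p ∷ L) ≡ occ13-2 (A ++ p ∷ L′)
occ13-2-++-cong []          L↭L′ eq = eq
occ13-2-++-cong (a ∷ [])    L↭L′ eq = cong₂ _+_ (countB-↭ L↭L′) eq
occ13-2-++-cong (a ∷ b ∷ A) {p} L↭L′ eq =
  cong₂ _+_ (countB-↭ (++⁺ˡ A (↭.prep p L↭L′))) (occ13-2-++-cong (b ∷ A) L↭L′ eq)

-- The letters before the run w are stored reversed in R, so that both letters framing
-- the block are list heads.
data Slide (x : ℕ) : List ℕ → List ℕ → Set where
  slide : ∀ {R w B} → All (_< x) w → x <head R → x <head B → All (x ≢_) R → All (x ≢_) B →
          Slide x (reverse R ++ w ++ x ∷ B) (reverse R ++ x ∷ w ++ B)

slide-↭ : ∀ {x π ρ} → Slide x π ρ → π ↭ ρ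
slide-↭ {x} (slide {R} {w} {B} _ _ _ _ _) = ++⁺ˡ (reverse R) (shift x w B)

occ13-2-slide : ∀ {x π ρ} → Slide x π ρ → occ13-2 π ≡ occ13-2 ρ
occ13-2-slide (slide {w = []} _ _ _ _ _) = refl
occ13-2-slide (slide {[]} {a ∷ w} w<x _ x<B _ x∉B) = occ13-2-jump w w<x x<B x∉B
occ13-2-slide {x} (slide {ℓ ∷ R} {a ∷ w} {B} w<x (just x<ℓ) x<B _ x∉B) = begin
  occ13-2 (reverse (ℓ ∷ R) ++ a ∷ w ++ x ∷ B) ≡⟨ cong occ13-2 (reverse-∷-++ (a ∷ w ++ x ∷ B)) ⟩
  occ13-2 (reverse R ++ ℓ ∷ a ∷ w ++ x ∷ B)   ≡⟨ occ13-2-++-cong (reverse R) (shift x (a ∷ w) B) boundary ⟩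
  occ13-2 (reverse R ++ ℓ ∷ x ∷ a ∷ w ++ B)   ≡⟨ cong occ13-2 (reverse-∷-++ (x ∷ a ∷ w ++ B)) ⟨
  occ13-2 (reverse (ℓ ∷ R) ++ x ∷ a ∷ w ++ B) ∎
  where
  open ≡-Reasoning
  reverse-∷-++ : ∀ Z → reverse (ℓ ∷ R) ++ Z ≡ reverse R ++ ℓ ∷ Z
  reverse-∷-++ Z = trans (sym (ʳ++-defn (ℓ ∷ R))) (ʳ++-defn R)
  boundary : occ13-2 (ℓ ∷ a ∷ w ++ x ∷ B) ≡ occ13-2 (ℓ ∷ x ∷ a ∷ w ++ B)
  boundary = begin
    occ13-2 (ℓ ∷ a ∷ w ++ x ∷ B) ≡⟨ occ13-2-descent (<⇒≤ (<-trans (All.head w<x) x<ℓ)) (w ++ x ∷ B) ⟩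
    occ13-2 (a ∷ w ++ x ∷ B)     ≡⟨ occ13-2-jump w w<x x<B x∉B ⟩
    occ13-2 (x ∷ a ∷ w ++ B)     ≡⟨ occ13-2-descent (<⇒≤ x<ℓ) (a ∷ w ++ B) ⟨
    occ13-2 (ℓ ∷ x ∷ a ∷ w ++ B) ∎

All-reverse : ∀ {P : ℕ → Set} {L} → All P L → All P (reverse L)
All-reverse {L = L} = All-resp-↭ (↭.↭-sym (↭-reverse L))

slide-reverse : ∀ {x π ρ} → Slide x π ρ → Slide x (reverse ρ) (reverse π)
slide-reverse {x} (slide {R} {w} {B} w<x x<R x<B x∉R x∉B) =
  subst₂ (Slide x) (sym reverse-ρ) (sym reverse-π) (slide (All-reverse w<x) x<B x<R x∉B x∉R)
  where
  open ≡-Reasoning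
  reverse-reverse-++ : ∀ M → reverse (reverse R ++ M) ≡ M ʳ++ R
  reverse-reverse-++ M = begin
    reverse (reverse R ++ M)           ≡⟨ reverse-++ (reverse R) M ⟩
    reverse M ++ reverse (reverse R)   ≡⟨ cong (reverse M ++_) (reverse-involutive R) ⟩
    reverse M ++ R                     ≡⟨ ʳ++-defn M ⟨
    M ʳ++ R                            ∎
  reverse-π : reverse (reverse R ++ w ++ x ∷ B) ≡ reverse B ++ x ∷ reverse w ++ R
  reverse-π = begin
    reverse (reverse R ++ w ++ x ∷ B)  ≡⟨ reverse-reverse-++ (w ++ x ∷ B) ⟩
    (w ++ x ∷ B) ʳ++ R                 ≡⟨ ++-ʳ++ w ⟩
    B ʳ++ x ∷ w ʳ++ R                  ≡⟨ ʳ++-defn B ⟩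
    reverse B ++ x ∷ w ʳ++ R           ≡⟨ cong (λ M → reverse B ++ x ∷ M) (ʳ++-defn w) ⟩
    reverse B ++ x ∷ reverse w ++ R    ∎
  reverse-ρ : reverse (reverse R ++ x ∷ w ++ B) ≡ reverse B ++ reverse w ++ x ∷ R
  reverse-ρ = begin
    reverse (reverse R ++ x ∷ w ++ B)  ≡⟨ reverse-reverse-++ (x ∷ w ++ B) ⟩
    (w ++ B) ʳ++ x ∷ R                 ≡⟨ ++-ʳ++ w ⟩
    B ʳ++ w ʳ++ x ∷ R                  ≡⟨ ʳ++-defn B ⟩
    reverse B ++ w ʳ++ x ∷ R           ≡⟨ cong (reverse B ++_) (ʳ++-defn w) ⟩
    reverse B ++ reverse w ++ x ∷ R    ∎

infix 4 _≈_
_≈_ : List ℕ → List ℕ → Set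
π ≈ ρ = π ↭ ρ × stat2-31 π ≡ stat2-31 ρ × stat13-2 π ≡ stat13-2 ρ

≈-refl : ∀ {π} → π ≈ π
≈-refl = ↭.refl , refl , refl

≈-sym : ∀ {π ρ} → π ≈ ρ → ρ ≈ π
≈-sym (π↭ρ , eq₁ , eq₂) = ↭.↭-sym π↭ρ , sym eq₁ , sym eq₂

≈-trans : ∀ {π ρ σ} → π ≈ ρ → ρ ≈ σ → π ≈ σ
≈-trans (π↭ρ , eq₁ , eq₂) (ρ↭σ , eq₁′ , eq₂′) = ↭.trans π↭ρ ρ↭σ , trans eq₁ eq₁′ , trans eq₂ eq₂′

≈-Unique : ∀ {π ρ} → π ≈ ρ → Unique π → Unique ρ
≈-Unique (π↭ρ , _) = Unique-resp-↭ (↭⇒↭ₛ π↭ρ)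

slide⇒≈ : ∀ {x π ρ} → Slide x π ρ → π ≈ ρ
slide⇒≈ {π = π} {ρ} s = slide-↭ s , same2-31 , same13-2
  where
  open ≡-Reasoning
  same2-31 : stat2-31 π ≡ stat2-31 ρ
  same2-31 = begin
    stat2-31 π            ≡⟨ stat2-31≡occ13-2∘reverse π ⟩
    occ13-2 (reverse π)   ≡⟨ occ13-2-slide (slide-reverse s) ⟨
    occ13-2 (reverse ρ)   ≡⟨ stat2-31≡occ13-2∘reverse ρ ⟨
    stat2-31 ρ            ∎
  same13-2 : stat13-2 π ≡ stat13-2 ρ
  same13-2 = begin
    stat13-2 π   ≡⟨ stat13-2≡occ13-2 π ⟩
    occ13-2 π    ≡⟨ occ13-2-slide s ⟩
    occ13-2 ρ    ≡⟨ stat13-2≡occ13-2 ρ ⟨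
    stat13-2 ρ   ∎

-- The modified Foata–Strehl action

breakAt-sound : ∀ x π {pre post} → breakAt x π ≡ just (pre , post) → π ≡ pre ++ x ∷ post
breakAt-sound x (y ∷ ys) eq with y ≡ᵇ x in y≡ᵇx
breakAt-sound x (y ∷ ys) refl | true = cong (_∷ ys) (≡ᵇ⇒≡ y x (subst T (sym y≡ᵇx) _))
... | false with breakAt x ys in eq′
breakAt-sound x (y ∷ ys) refl | false | just _ = cong (y ∷_) (breakAt-sound x ys eq′)

∉-around : ∀ {x} pre {post} → Unique (pre ++ x ∷ post) → All (x ≢_) pre × All (x ≢_) post
∉-around {x} pre {post} u with Unique-resp-↭ (↭⇒↭ₛ (shift x pre post)) u
... | x∉ ∷ _ = ++⁻ pre x∉

spanB-below : ∀ {x} L {w rest} → All (x ≢_) L → spanB (_<ᵇ x) L ≡ (w , rest) →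
  L ≡ w ++ rest × All (_< x) w × x <head rest × All (x ≢_) rest
spanB-below [] [] refl = refl , [] , nothing , []
spanB-below {x} (y ∷ ys) x∉ eq with y <ᵇ x in y<ᵇx
spanB-below {x} (y ∷ ys) x∉@(x≢y ∷ _) refl | false =
  refl , [] , just (≤∧≢⇒< (≮⇒≥ (λ y<x → subst T y<ᵇx (<⇒<ᵇ y<x))) x≢y) , x∉
... | true with spanB (_<ᵇ x) ys in eq′
spanB-below {x} (y ∷ ys) (_ ∷ x∉ys) refl | true | _ with spanB-below ys x∉ys eq′
... | ys≡ , w<x , x<rest , x∉rest =
  cong (y ∷_) ys≡ , <ᵇ⇒< y x (subst T (sym y<ᵇx) _) ∷ w<x , x<rest , x∉rest

spanB-above : ∀ {x L} → x <head L → spanB (_<ᵇ x) L ≡ ([] , L)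
spanB-above {L = []}    nothing                                       = refl
spanB-above {L = y ∷ _} (just x<y) rewrite <ᵇ-≡ (ofⁿ (<⇒≯ x<y)) = refl

rightNb-above : ∀ {n x} post → (x <ᵇ rightNb n post) ≡ true → x <head post
rightNb-above []              _  = nothing
rightNb-above {x = x} (y ∷ _) lt = just (<ᵇ⇒< x y (subst T (sym lt) _))

leftNb-above : ∀ {n x} pre → (x <ᵇ leftNb n pre) ≡ true → x <head reverse pre
leftNb-above {n} {x} pre lt with reverse pre
... | []    = nothing
... | y ∷ _ = just (<ᵇ⇒< x y (subst T (sym lt) _))

doubleAscent⇒rightNb-above : ∀ {n x π} → isDoubleAscent n x π ≡ true →
  ∃[ pre ] ∃[ post ] breakAt x π ≡ just (pre , post) × x <head post
doubleAscent⇒rightNb-above {n} {x} {π} da with breakAt x π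
doubleAscent⇒rightNb-above () | nothing
... | just (pre , post) with leftNb n pre <ᵇ x
doubleAscent⇒rightNb-above da | just (pre , post) | true = pre , post , refl , rightNb-above post da

doubleDescent⇒leftNb-above : ∀ {n x π} → isDoubleDescent n x π ≡ true →
  ∃[ pre ] ∃[ post ] breakAt x π ≡ just (pre , post) × x <head reverse pre
doubleDescent⇒leftNb-above {n} {x} {π} dd with breakAt x π
doubleDescent⇒leftNb-above () | nothing
... | just (pre , post) with x <ᵇ leftNb n pre in lt
doubleDescent⇒leftNb-above dd | just (pre , post) | true = pre , post , refl , leftNb-above pre lt

φ-slides-left : ∀ {x π pre post} → Unique π → breakAt x π ≡ just (pre , post) → x <head post →
  Slide x π (φ x π)
φ-slides-left {x} {π} {pre} {post} u eq x<post
  with π≡ ← breakAt-sound x π eq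
  with x∉pre , x∉post ← ∉-around pre (subst Unique π≡ u)
  rewrite eq | spanB-above x<post
  with spanB (_<ᵇ x) (reverse pre) in s
... | rw₂ , rw₁
  with rev-pre≡ , rw₂<x , x<rw₁ , x∉rw₁ ← spanB-below (reverse pre) (All-reverse x∉pre) s
  = subst (λ σ → Slide x σ _) (sym π≡′) (slide (All-reverse rw₂<x) x<rw₁ x<post x∉rw₁ x∉post)
  where
  open ≡-Reasoning
  π≡′ : π ≡ reverse rw₁ ++ reverse rw₂ ++ x ∷ post
  π≡′ = begin
    π                                         ≡⟨ π≡ ⟩
    pre ++ x ∷ post                           ≡⟨ cong (_++ x ∷ post) (reverse-involutive pre) ⟨
    reverse (reverse pre) ++ x ∷ post         ≡⟨ cong (λ L → reverse L ++ x ∷ post) rev-pre≡ ⟩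
    reverse (rw₂ ++ rw₁) ++ x ∷ post          ≡⟨ cong (_++ x ∷ post) (reverse-++ rw₂ rw₁) ⟩
    (reverse rw₁ ++ reverse rw₂) ++ x ∷ post  ≡⟨ ++-assoc (reverse rw₁) (reverse rw₂) (x ∷ post) ⟩
    reverse rw₁ ++ reverse rw₂ ++ x ∷ post    ∎

φ-slides-right : ∀ {x π pre post} → Unique π → breakAt x π ≡ just (pre , post) → x <head reverse pre →
  Slide x (φ x π) π
φ-slides-right {x} {π} {pre} {post} u eq x<pre
  with π≡ ← breakAt-sound x π eq
  with x∉pre , x∉post ← ∉-around pre (subst Unique π≡ u)
  rewrite eq | spanB-above x<pre
  with spanB (_<ᵇ x) post in s
... | w , rest
  with post≡ , w<x , x<rest , x∉rest ← spanB-below post x∉post s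
  = subst (Slide x _) (sym π≡′) (slide w<x x<pre x<rest (All-reverse x∉pre) x∉rest)
  where
  π≡′ : π ≡ reverse (reverse pre) ++ x ∷ w ++ rest
  π≡′ = trans π≡ (cong₂ (λ A B → A ++ x ∷ B) (sym (reverse-involutive pre)) post≡)

φ′-≈ : ∀ n x π → Unique π → φ′ n x π ≈ π
φ′-≈ n x π u with isDoubleAscent n x π in da | isDoubleDescent n x π in dd
... | true  | _ = let _ , _ , eq , x<post = doubleAscent⇒rightNb-above {n} {x} {π} da in
  ≈-sym (slide⇒≈ (φ-slides-left u eq x<post))
... | false | true = let _ , _ , eq , x<pre = doubleDescent⇒leftNb-above {n} {x} {π} dd in
  slide⇒≈ (φ-slides-right u eq x<pre)
... | false | false = ≈-refl

foldl-≈ : ∀ {A : Set} (f : List ℕ → A → List ℕ) → (∀ ρ a → Unique ρ → f ρ a ≈ ρ) →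
  ∀ as {ρ} → Unique ρ → foldl f ρ as ≈ ρ
foldl-≈ f step []       u = ≈-refl
foldl-≈ f step (a ∷ as) u =
  ≈-trans (foldl-≈ f step as (≈-Unique (≈-sym (step _ a u)) u)) (step _ a u)

φ′S-≈ : ∀ n S π → Unique π → φ′S n S π ≈ π
φ′S-≈ n S π = foldl-≈ _ step (allFin n)
  where
  step : ∀ ρ i → Unique ρ → (if lookup S i then φ′ n (suc (toℕ i)) ρ else ρ) ≈ ρ
  step ρ i u with lookup S i
  ... | true  = φ′-≈ n (suc (toℕ i)) ρ u
  ... | false = ≈-refl

IsPerm⇒Unique : ∀ {n π} → IsPerm n π → Unique π
IsPerm⇒Unique {n} π↭ =
  Unique-resp-↭ (↭⇒↭ₛ (↭.↭-sym π↭)) (applyUpTo⁺₁ suc n (λ i<j _ → <⇒≢ i<j ∘ suc-injective))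

theorem5p1 : (n : ℕ) (π : List ℕ) → IsPerm n π → (S : Subset n) →
    (stat2-31 (φ′S n S π) ≡ stat2-31 π) × (stat13-2 (φ′S n S π) ≡ stat13-2 π)
theorem5p1 n π isPerm S = proj₂ (φ′S-≈ n S π (IsPerm⇒Unique isPerm))
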